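{- For every valise $(4,1)$ adinkra $A$, $\operatorname{tr}(X_A\cdot X_A)=\operatorname{tr}\Big(\big[(\phi_{12}+\phi_{34})^2+(\phi_{13}+\phi_{24})^2+(\phi_{14}+\phi_{23})^2\big]\big|_F\Big)$.
   Context: Vertices: bosons $B=\{b_1,\dots,b_4\}$, fermions $F=\{f_1,\dots,f_4\}$. A valise $(4,1)$ adinkra is $K_{4,4}$ between $B$ and $F$ with edges colored by $\{1,2,3,4\}$ (each vertex has one edge of each color; any two colors form a disjoint union of $4$-cycles) and an odd dashing (every two-colored $4$-cycle has an odd number of dashed edges). For color $I$, $L_I$ is the $4\times4$ matrix (rows bosons, columns fermions) with $(i,j)$ entry $+1$/$-1$ if $b_i,f_j$ are joined by a solid/dashed edge of color $I$, else $0$; $R_I=L_I^T$; with basis ordered fermions first, $\phi_I=\begin{bmatrix}0&R_I\\L_I&0\end{bmatrix}$ and $\phi_{IJ}=\phi_I\phi_J$ (block diagonal); $(\cdot)|_F$ is the fermionic (upper-left) $4\times4$ block. $X_A=\sum_{1\le I<J\le4}(\phi_{IJ})|_F$. -}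

module Defs where

open import Data.Nat using (ℕ; zero; suc)
open import Data.Fin using (Fin; zero; suc; splitAt; _↑ˡ_)
open import Data.Sum using (inj₁; inj₂)
open import Data.Bool using (Bool; true; false; if_then_else_; _xor_)
open import Data.Integer using (ℤ; 0ℤ; 1ℤ; -1ℤ; _+_; _*_)
open import Data.Product using (Σ; _×_)
open import Relation.Binary.PropositionalEquality using (_≡_)
open import Relation.Nullary using (¬_; yes; no)
import Data.Fin as F

∑ : ∀ {n} → (Fin n → ℤ) → ℤ
∑ {zero}  f = 0ℤ
∑ {suc n} f = f zero + ∑ (λ i → f (suc i))

Mat : ℕ → ℕ → Set
Mat m n = Fin m → Fin n → ℤ

_⊗_ : ∀ {m n p} → Mat m n → Mat n p → Mat m p
(A ⊗ B) i k = ∑ (λ j → A i j * B j k)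

_⊕_ : ∀ {m n} → Mat m n → Mat m n → Mat m n
(A ⊕ B) i j = A i j + B i j

transpose : ∀ {m n} → Mat m n → Mat n m
transpose A i j = A j i

tr : ∀ {n} → Mat n n → ℤ
tr A = ∑ (λ i → A i i)

-- Bosons b₁..b₄ = Fin 4, fermions f₁..f₄ = Fin 4, colours 1..4 = Fin 4
-- (colour I is represented by the element of Fin 4 with toℕ = I - 1).
Boson Fermion Colour : Set
Boson = Fin 4
Fermion = Fin 4
Colour = Fin 4

-- A valise (4,1) adinkra: the complete bipartite graph K_{4,4};
-- colour b f is the colour of the edge {b,f}, dashed b f says whether it is dashed.
record Adinkra : Set where
  field
    colour : Boson → Fermion → Colour
    dashed : Boson → Fermion → Bool
    bosonColours : ∀ (b : Boson) (I : Colour) →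
      Σ Fermion (λ f → colour b f ≡ I × (∀ f′ → colour b f′ ≡ I → f′ ≡ f))
    fermionColours : ∀ (f : Fermion) (I : Colour) →
      Σ Boson (λ b → colour b f ≡ I × (∀ b′ → colour b′ f ≡ I → b′ ≡ b))
    -- any two colours form a disjoint union of 4-cycles: every path
    -- b₁ -I- f₁ -J- b₂ -I- f₂ closes up with a J-edge f₂ - b₁
    fourCycles : ∀ (I J : Colour) → ¬ I ≡ J → ∀ (b₁ b₂ : Boson) (f₁ f₂ : Fermion) →
      colour b₁ f₁ ≡ I → colour b₂ f₁ ≡ J → colour b₂ f₂ ≡ I → colour b₁ f₂ ≡ J
    oddDashing : ∀ (I J : Colour) → ¬ I ≡ J → ∀ (b₁ b₂ : Boson) (f₁ f₂ : Fermion) →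
      colour b₁ f₁ ≡ I → colour b₂ f₁ ≡ J → colour b₂ f₂ ≡ I → colour b₁ f₂ ≡ J →
      (dashed b₁ f₁ xor dashed b₂ f₁ xor dashed b₂ f₂ xor dashed b₁ f₂) ≡ true

module _ (A : Adinkra) where
  open Adinkra A

  -- L_I : rows bosons, columns fermions
  L : Colour → Mat 4 4
  L I b f with colour b f F.≟ I
  ... | yes _ = if dashed b f then -1ℤ else 1ℤ
  ... | no _  = 0ℤ

  R : Colour → Mat 4 4
  R I = transpose (L I)

  -- φ_I on the 8-dimensional space, basis ordered fermions (first 4) then bosons.
  φ : Colour → Mat 8 8
  φ I i j with splitAt 4 i | splitAt 4 j
  ... | inj₁ f | inj₁ f′ = 0ℤ
  ... | inj₁ f | inj₂ b  = R I f b
  ... | inj₂ b | inj₁ f  = L I b f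
  ... | inj₂ b | inj₂ b′ = 0ℤ

  φ₂ : Colour → Colour → Mat 8 8
  φ₂ I J = φ I ⊗ φ J

-- fermionic (upper-left) 4×4 block
restrictF : Mat 8 8 → Mat 4 4
restrictF M i j = M (i ↑ˡ 4) (j ↑ˡ 4)

c1 c2 c3 c4 : Colour
c1 = zero
c2 = suc zero
c3 = suc (suc zero)
c4 = suc (suc (suc zero))

X : Adinkra → Mat 4 4
X A = restrictF (φ₂ A c1 c2) ⊕ (restrictF (φ₂ A c1 c3) ⊕ (restrictF (φ₂ A c1 c4)
    ⊕ (restrictF (φ₂ A c2 c3) ⊕ (restrictF (φ₂ A c2 c4) ⊕ restrictF (φ₂ A c3 c4)))))

sq : ∀ {n} → Mat n n → Mat n n
sq M = M ⊗ M

RHS : Adinkra → ℤ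
RHS A = tr (restrictF (sq (φ₂ A c1 c2 ⊕ φ₂ A c3 c4)
                    ⊕ (sq (φ₂ A c1 c3 ⊕ φ₂ A c2 c4)
                    ⊕ sq (φ₂ A c1 c4 ⊕ φ₂ A c2 c3))))

-- The fermionic block of φ_I φ_J is R_I L_J, so tr (R_I L_J R_K L_M) is a signed count of
-- closed walks b -I- f -M- b′ -K- f′ -J- b. If the colour pairs {I,J} and {K,M} share exactly
-- one colour there is no such walk: two edges of one colour at a common vertex coincide, and
-- by the 4-cycle property two opposite edges of equal colour force the other two to agree.
-- Hence the fermionic blocks Y₁, Y₂, Y₃ of φ₁₂ + φ₃₄, φ₁₃ + φ₂₄, φ₁₄ + φ₂₃, which sum to X_A,
-- are pairwise orthogonal for (P , Q) ↦ tr (P Q), and tr (X_A²) = Σ tr (Y_k²).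
module Submission where

open import Data.Nat using (ℕ; zero; suc) renaming (_+_ to _+ℕ_)
open import Data.Fin using (Fin; zero; suc; _↑ˡ_; _↑ʳ_; _≟_)
open import Data.Fin.Properties using (splitAt-↑ˡ; splitAt-↑ʳ)
open import Data.Integer using (ℤ; 0ℤ; _+_; _*_)
open import Data.Integer.Properties
  using (*-zeroˡ; *-zeroʳ; *-comm; *-distribˡ-+; *-distribʳ-+; +-identityˡ; +-identityʳ; +-assoc)
open import Data.Integer.Tactic.RingSolver using (solve-∀)
open import Data.Product using (_×_; _,_)
open import Data.Sum using (_⊎_; inj₁; inj₂)
open import Function using (_∘_)
open import Relation.Binary.PropositionalEquality
  using (_≡_; _≢_; refl; sym; trans; cong; cong₂; module ≡-Reasoning)
open import Relation.Nullary using (¬_; Dec; yes; no; contradiction)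
open import Relation.Nullary.Decidable using (False; toWitnessFalse; _×-dec_; _→-dec_)

open import Defs

open ≡-Reasoning

zero-*ˡ : ∀ {x} y → x ≡ 0ℤ → x * y ≡ 0ℤ
zero-*ˡ y refl = *-zeroˡ y

zero-*ʳ : ∀ x {y} → y ≡ 0ℤ → x * y ≡ 0ℤ
zero-*ʳ x refl = *-zeroʳ x

*-zero⁴ : ∀ x y z w → x ≡ 0ℤ ⊎ y ≡ 0ℤ ⊎ z ≡ 0ℤ ⊎ w ≡ 0ℤ → (x * y) * (z * w) ≡ 0ℤ
*-zero⁴ x y z w (inj₁ x≡0)               = zero-*ˡ (z * w) (zero-*ˡ y x≡0)
*-zero⁴ x y z w (inj₂ (inj₁ y≡0))        = zero-*ˡ (z * w) (zero-*ʳ x y≡0)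
*-zero⁴ x y z w (inj₂ (inj₂ (inj₁ z≡0))) = zero-*ʳ (x * y) (zero-*ˡ w z≡0)
*-zero⁴ x y z w (inj₂ (inj₂ (inj₂ w≡0))) = zero-*ʳ (x * y) (zero-*ʳ z w≡0)

∑-cong : ∀ {n} {f g : Fin n → ℤ} → (∀ i → f i ≡ g i) → ∑ f ≡ ∑ g
∑-cong {zero}  f≡g = refl
∑-cong {suc n} f≡g = cong₂ _+_ (f≡g zero) (∑-cong (f≡g ∘ suc))

∑-zero : ∀ {n} {f : Fin n → ℤ} → (∀ i → f i ≡ 0ℤ) → ∑ f ≡ 0ℤ
∑-zero {zero}  f≡0 = refl
∑-zero {suc n} f≡0 = cong₂ _+_ (f≡0 zero) (∑-zero (f≡0 ∘ suc))

∑-distrib-+ : ∀ {n} (f g : Fin n → ℤ) → ∑ (λ i → f i + g i) ≡ ∑ f + ∑ g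
∑-distrib-+ {zero}  f g = refl
∑-distrib-+ {suc n} f g = begin
  (f zero + g zero) + ∑ (λ i → f (suc i) + g (suc i))
    ≡⟨ cong ((f zero + g zero) +_) (∑-distrib-+ (f ∘ suc) (g ∘ suc)) ⟩
  (f zero + g zero) + (∑ (f ∘ suc) + ∑ (g ∘ suc))
    ≡⟨ interchange (f zero) (g zero) (∑ (f ∘ suc)) (∑ (g ∘ suc)) ⟩
  (f zero + ∑ (f ∘ suc)) + (g zero + ∑ (g ∘ suc)) ∎
  where
  interchange : ∀ a b c d → (a + b) + (c + d) ≡ (a + c) + (b + d)
  interchange = solve-∀

*-distribˡ-∑ : ∀ {n} x (f : Fin n → ℤ) → x * ∑ f ≡ ∑ (λ i → x * f i)
*-distribˡ-∑ {zero}  x f = *-zeroʳ x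
*-distribˡ-∑ {suc n} x f =
  trans (*-distribˡ-+ x (f zero) _) (cong (x * f zero +_) (*-distribˡ-∑ x (f ∘ suc)))

*-distribʳ-∑ : ∀ {n} x (f : Fin n → ℤ) → ∑ f * x ≡ ∑ (λ i → f i * x)
*-distribʳ-∑ {zero}  x f = *-zeroˡ x
*-distribʳ-∑ {suc n} x f =
  trans (*-distribʳ-+ x (f zero) _) (cong (f zero * x +_) (*-distribʳ-∑ x (f ∘ suc)))

∑-comm : ∀ {m n} (f : Fin m → Fin n → ℤ) → ∑ (λ i → ∑ (f i)) ≡ ∑ (λ j → ∑ (λ i → f i j))
∑-comm {zero} {n} f = sym (∑-zero {n} (λ _ → refl))
∑-comm {suc m} f = begin
  ∑ (f zero) + ∑ (λ i → ∑ (f (suc i)))         ≡⟨ cong (∑ (f zero) +_) (∑-comm (f ∘ suc)) ⟩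
  ∑ (f zero) + ∑ (λ j → ∑ (λ i → f (suc i) j)) ≡⟨ sym (∑-distrib-+ (f zero) _) ⟩
  ∑ (λ j → f zero j + ∑ (λ i → f (suc i) j))   ∎

∑-↑ : ∀ m {n} (g : Fin (m +ℕ n) → ℤ) → ∑ g ≡ ∑ (λ i → g (i ↑ˡ n)) + ∑ (λ j → g (m ↑ʳ j))
∑-↑ zero    g = sym (+-identityˡ _)
∑-↑ (suc m) g = trans (cong (g zero +_) (∑-↑ m (g ∘ suc))) (sym (+-assoc (g zero) _ _))

∑*∑≡0 : ∀ {m n} (f : Fin m → ℤ) (g : Fin n → ℤ) → (∀ i j → f i * g j ≡ 0ℤ) → ∑ f * ∑ g ≡ 0ℤ
∑*∑≡0 f g fg≡0 = trans (*-distribʳ-∑ (∑ g) f)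
  (∑-zero (λ i → trans (*-distribˡ-∑ (f i) g) (∑-zero (fg≡0 i))))

infix 4 _≐_ _⟂_

_≐_ : ∀ {m n} → Mat m n → Mat m n → Set
P ≐ Q = ∀ i j → P i j ≡ Q i j

IsZero : ∀ {m n} → Mat m n → Set
IsZero P = ∀ i j → P i j ≡ 0ℤ

-- A record, so that P and Q can be inferred from a proof of P ⟂ Q.
record _⟂_ {n} (P Q : Mat n n) : Set where
  constructor orthogonal
  field tr-⊗≡0 : tr (P ⊗ Q) ≡ 0ℤ
open _⟂_

tr-⊕ : ∀ {n} (P Q : Mat n n) → tr (P ⊕ Q) ≡ tr P + tr Q
tr-⊕ P Q = ∑-distrib-+ (λ i → P i i) (λ i → Q i i)

⊗-cong : ∀ {m n p} {P P′ : Mat m n} {Q Q′ : Mat n p} → P ≐ P′ → Q ≐ Q′ → P ⊗ Q ≐ P′ ⊗ Q′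
⊗-cong P≐P′ Q≐Q′ i k = ∑-cong (λ j → cong₂ _*_ (P≐P′ i j) (Q≐Q′ j k))

tr-⊗-cong : ∀ {m n} {P P′ : Mat m n} {Q Q′ : Mat n m} → P ≐ P′ → Q ≐ Q′ → tr (P ⊗ Q) ≡ tr (P′ ⊗ Q′)
tr-⊗-cong P≐P′ Q≐Q′ = ∑-cong (λ i → ⊗-cong P≐P′ Q≐Q′ i i)

tr-⊗-comm : ∀ {m n} (P : Mat m n) (Q : Mat n m) → tr (P ⊗ Q) ≡ tr (Q ⊗ P)
tr-⊗-comm P Q = trans (∑-comm (λ i j → P i j * Q j i))
  (∑-cong (λ j → ∑-cong (λ i → *-comm (P i j) (Q j i))))

tr-⊗-distribʳ-⊕ : ∀ {n} (P Q C : Mat n n) → tr ((P ⊕ Q) ⊗ C) ≡ tr (P ⊗ C) + tr (Q ⊗ C)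
tr-⊗-distribʳ-⊕ P Q C = trans
  (∑-cong (λ i → trans (∑-cong (λ j → *-distribʳ-+ (C j i) (P i j) (Q i j)))
                       (∑-distrib-+ (λ j → P i j * C j i) (λ j → Q i j * C j i))))
  (∑-distrib-+ (λ i → (P ⊗ C) i i) (λ i → (Q ⊗ C) i i))

tr-⊗-distribˡ-⊕ : ∀ {n} (C P Q : Mat n n) → tr (C ⊗ (P ⊕ Q)) ≡ tr (C ⊗ P) + tr (C ⊗ Q)
tr-⊗-distribˡ-⊕ C P Q = trans
  (∑-cong (λ i → trans (∑-cong (λ j → *-distribˡ-+ (C i j) (P j i) (Q j i)))
                       (∑-distrib-+ (λ j → C i j * P j i) (λ j → C i j * Q j i))))
  (∑-distrib-+ (λ i → (C ⊗ P) i i) (λ i → (C ⊗ Q) i i))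

⟂-sym : ∀ {n} {P Q : Mat n n} → P ⟂ Q → Q ⟂ P
⟂-sym {P = P} {Q} P⟂Q = orthogonal (trans (tr-⊗-comm Q P) (tr-⊗≡0 P⟂Q))

⟂-⊕ˡ : ∀ {n} {P Q C : Mat n n} → P ⟂ C → Q ⟂ C → P ⊕ Q ⟂ C
⟂-⊕ˡ {P = P} {Q} {C} P⟂C Q⟂C = orthogonal (begin
  tr ((P ⊕ Q) ⊗ C)          ≡⟨ tr-⊗-distribʳ-⊕ P Q C ⟩
  tr (P ⊗ C) + tr (Q ⊗ C)   ≡⟨ cong₂ _+_ (tr-⊗≡0 P⟂C) (tr-⊗≡0 Q⟂C) ⟩
  0ℤ ∎)

⟂-⊕ʳ : ∀ {n} {C P Q : Mat n n} → C ⟂ P → C ⟂ Q → C ⟂ P ⊕ Q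
⟂-⊕ʳ {C = C} {P} {Q} C⟂P C⟂Q = orthogonal (begin
  tr (C ⊗ (P ⊕ Q))          ≡⟨ tr-⊗-distribˡ-⊕ C P Q ⟩
  tr (C ⊗ P) + tr (C ⊗ Q)   ≡⟨ cong₂ _+_ (tr-⊗≡0 C⟂P) (tr-⊗≡0 C⟂Q) ⟩
  0ℤ ∎)

tr-sq-⊕ : ∀ {n} {P Q : Mat n n} → P ⟂ Q → tr (sq (P ⊕ Q)) ≡ tr (sq P) + tr (sq Q)
tr-sq-⊕ {P = P} {Q} P⟂Q = begin
  tr ((P ⊕ Q) ⊗ (P ⊕ Q))                                ≡⟨ tr-⊗-distribʳ-⊕ P Q (P ⊕ Q) ⟩
  tr (P ⊗ (P ⊕ Q)) + tr (Q ⊗ (P ⊕ Q))                   ≡⟨ cong₂ _+_ (tr-⊗-distribˡ-⊕ P P Q) (tr-⊗-distribˡ-⊕ Q P Q) ⟩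
  (tr (sq P) + tr (P ⊗ Q)) + (tr (Q ⊗ P) + tr (sq Q))   ≡⟨ cong₂ _+_ (cong (tr (sq P) +_) (tr-⊗≡0 P⟂Q)) (cong (_+ tr (sq Q)) (tr-⊗≡0 (⟂-sym P⟂Q))) ⟩
  (tr (sq P) + 0ℤ) + (0ℤ + tr (sq Q))                   ≡⟨ cong₂ _+_ (+-identityʳ (tr (sq P))) (+-identityˡ (tr (sq Q))) ⟩
  tr (sq P) + tr (sq Q) ∎

-- restrictF is topLeft {4} {4}.
module _ {m n : ℕ} where

  topLeft : Mat (m +ℕ n) (m +ℕ n) → Mat m m
  topLeft P i j = P (i ↑ˡ n) (j ↑ˡ n)

  topRight : Mat (m +ℕ n) (m +ℕ n) → Mat m n
  topRight P i j = P (i ↑ˡ n) (m ↑ʳ j)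

  bottomLeft : Mat (m +ℕ n) (m +ℕ n) → Mat n m
  bottomLeft P i j = P (m ↑ʳ i) (j ↑ˡ n)

  bottomRight : Mat (m +ℕ n) (m +ℕ n) → Mat n n
  bottomRight P i j = P (m ↑ʳ i) (m ↑ʳ j)

  topLeft-⊗ : ∀ P Q → IsZero (topRight P) → topLeft (P ⊗ Q) ≐ topLeft P ⊗ topLeft Q
  topLeft-⊗ P Q P₁₂≡0 i j = begin
    (P ⊗ Q) (i ↑ˡ n) (j ↑ˡ n)                      ≡⟨ ∑-↑ m _ ⟩
    (topLeft P ⊗ topLeft Q) i j + ∑ (λ k → topRight P i k * bottomLeft Q k j)
      ≡⟨ cong ((topLeft P ⊗ topLeft Q) i j +_) (∑-zero (λ k → zero-*ˡ (bottomLeft Q k j) (P₁₂≡0 i k))) ⟩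
    (topLeft P ⊗ topLeft Q) i j + 0ℤ               ≡⟨ +-identityʳ _ ⟩
    (topLeft P ⊗ topLeft Q) i j ∎

  topLeft-⊗-offDiagonal : ∀ P Q → IsZero (topLeft P) → topLeft (P ⊗ Q) ≐ topRight P ⊗ bottomLeft Q
  topLeft-⊗-offDiagonal P Q P₁₁≡0 i j = begin
    (P ⊗ Q) (i ↑ˡ n) (j ↑ˡ n)                      ≡⟨ ∑-↑ m _ ⟩
    (topLeft P ⊗ topLeft Q) i j + (topRight P ⊗ bottomLeft Q) i j
      ≡⟨ cong (_+ (topRight P ⊗ bottomLeft Q) i j) (∑-zero (λ k → zero-*ˡ (topLeft Q k j) (P₁₁≡0 i k))) ⟩
    0ℤ + (topRight P ⊗ bottomLeft Q) i j           ≡⟨ +-identityˡ _ ⟩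
    (topRight P ⊗ bottomLeft Q) i j ∎

  topRight-⊗-offDiagonal : ∀ P Q → IsZero (topLeft P) → IsZero (bottomRight Q) → IsZero (topRight (P ⊗ Q))
  topRight-⊗-offDiagonal P Q P₁₁≡0 Q₂₂≡0 i j =
    trans (∑-↑ m _) (cong₂ _+_ (∑-zero (λ k → zero-*ˡ (Q (k ↑ˡ n) (m ↑ʳ j)) (P₁₁≡0 i k)))
                               (∑-zero (λ k → zero-*ʳ (P (i ↑ˡ n) (m ↑ʳ k)) (Q₂₂≡0 k j))))

  tr-topLeft-sq : ∀ P → IsZero (topRight P) → tr (topLeft (sq P)) ≡ tr (sq (topLeft P))
  tr-topLeft-sq P P₁₂≡0 = ∑-cong (λ i → topLeft-⊗ P P P₁₂≡0 i i)

-- For I ≢ J and K ≢ M this says that {K, M} is either {I, J} or disjoint from it.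
EqualOrDisjoint : Colour → Colour → Colour → Colour → Set
EqualOrDisjoint I J K M = (K ≡ I → M ≡ J) × (K ≡ J → M ≡ I) × (M ≡ I → K ≡ J) × (M ≡ J → K ≡ I)

equalOrDisjoint? : ∀ I J K M → Dec (EqualOrDisjoint I J K M)
equalOrDisjoint? I J K M =
  ((K ≟ I) →-dec (M ≟ J)) ×-dec ((K ≟ J) →-dec (M ≟ I)) ×-dec
  ((M ≟ I) →-dec (K ≟ J)) ×-dec ((M ≟ J) →-dec (K ≟ I))

module _ (A : Adinkra) where
  open Adinkra A

  topLeft-φ : ∀ I → IsZero (topLeft {4} {4} (φ A I))
  topLeft-φ I f f′ rewrite splitAt-↑ˡ 4 f 4 | splitAt-↑ˡ 4 f′ 4 = refl

  bottomRight-φ : ∀ I → IsZero (bottomRight {4} {4} (φ A I))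
  bottomRight-φ I b b′ rewrite splitAt-↑ʳ 4 4 b | splitAt-↑ʳ 4 4 b′ = refl

  topRight-φ : ∀ I → topRight {4} {4} (φ A I) ≐ R A I
  topRight-φ I f b rewrite splitAt-↑ˡ 4 f 4 | splitAt-↑ʳ 4 4 b = refl

  bottomLeft-φ : ∀ I → bottomLeft {4} {4} (φ A I) ≐ L A I
  bottomLeft-φ I b f rewrite splitAt-↑ʳ 4 4 b | splitAt-↑ˡ 4 f 4 = refl

  fermionic : Colour → Colour → Mat 4 4
  fermionic I J = restrictF (φ₂ A I J)

  fermionic≐RL : ∀ I J → fermionic I J ≐ R A I ⊗ L A J
  fermionic≐RL I J f f′ = trans (topLeft-⊗-offDiagonal (φ A I) (φ A J) (topLeft-φ I) f f′)
                                (⊗-cong (topRight-φ I) (bottomLeft-φ J) f f′)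

  topRight-φ₂ : ∀ I J → IsZero (topRight {4} {4} (φ₂ A I J))
  topRight-φ₂ I J = topRight-⊗-offDiagonal (φ A I) (φ A J) (topLeft-φ I) (bottomRight-φ J)

  L-support : ∀ I b f → colour b f ≡ I ⊎ L A I b f ≡ 0ℤ
  L-support I b f with colour b f ≟ I
  ... | yes c≡I = inj₁ c≡I
  ... | no _    = inj₂ refl

  boson-unique : ∀ {I f b b′} → colour b f ≡ I → colour b′ f ≡ I → b ≡ b′
  boson-unique {I} {f} p q with fermionColours f I
  ... | _ , _ , unique = trans (unique _ p) (sym (unique _ q))

  record Square (I J K M : Colour) (b : Boson) (f f′ : Fermion) (b′ : Boson) : Set where
    constructor square
    field
      bf   : colour b f ≡ I
      bf′  : colour b f′ ≡ J
      b′f′ : colour b′ f′ ≡ K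
      b′f  : colour b′ f ≡ M

  module _ {I J K M : Colour} {b b′ : Boson} {f f′ : Fermion} where

    Square-rotate : Square I J K M b f f′ b′ → Square K M I J b′ f′ f b
    Square-rotate (square p q r s) = square r s p q

    Square-reverse : Square I J K M b f f′ b′ → Square J I M K b f′ f b′
    Square-reverse (square p q r s) = square q p s r

    Square-adjacent : Square I J K M b f f′ b′ → J ≡ K → I ≡ M
    Square-adjacent (square p q r s) refl with boson-unique q r
    ... | refl = trans (sym p) s

    Square-opposite : I ≢ J → Square I J K M b f f′ b′ → I ≡ K → J ≡ M
    Square-opposite I≢J (square p q r s) refl = trans (sym (fourCycles I J I≢J b′ b f′ f r q p)) s

  Square-equalOrDisjoint : ∀ {I J K M b f f′ b′} → I ≢ J → Square I J K M b f f′ b′ → EqualOrDisjoint I J K M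
  Square-equalOrDisjoint I≢J sq =
    (λ K≡I → sym (Square-opposite I≢J sq (sym K≡I))) ,
    (λ K≡J → sym (Square-adjacent sq (sym K≡J))) ,
    Square-adjacent (Square-rotate sq) ,
    (λ M≡J → sym (Square-opposite (I≢J ∘ sym) (Square-reverse sq) (sym M≡J)))

  square-or-vanishing-factor : ∀ {I J K M} b f f′ b′ → Square I J K M b f f′ b′ ⊎
    (L A I b f ≡ 0ℤ ⊎ L A J b f′ ≡ 0ℤ ⊎ L A K b′ f′ ≡ 0ℤ ⊎ L A M b′ f ≡ 0ℤ)
  square-or-vanishing-factor {I} {J} {K} {M} b f f′ b′
    with L-support I b f | L-support J b f′ | L-support K b′ f′ | L-support M b′ f
  ... | inj₁ p   | inj₁ q   | inj₁ r   | inj₁ s   = inj₁ (square p q r s)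
  ... | inj₂ x≡0 | _        | _        | _        = inj₂ (inj₁ x≡0)
  ... | inj₁ _   | inj₂ y≡0 | _        | _        = inj₂ (inj₂ (inj₁ y≡0))
  ... | inj₁ _   | inj₁ _   | inj₂ z≡0 | _        = inj₂ (inj₂ (inj₂ (inj₁ z≡0)))
  ... | inj₁ _   | inj₁ _   | inj₁ _   | inj₂ w≡0 = inj₂ (inj₂ (inj₂ (inj₂ w≡0)))

  L-product-vanishes : ∀ {I J K M} b f f′ b′ → ¬ Square I J K M b f f′ b′ →
    (L A I b f * L A J b f′) * (L A K b′ f′ * L A M b′ f) ≡ 0ℤ
  L-product-vanishes b f f′ b′ noSquare with square-or-vanishing-factor b f f′ b′
  ... | inj₁ sq           = contradiction sq noSquare
  ... | inj₂ some-factor≡0 = *-zero⁴ _ _ _ _ some-factor≡0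

  RL-⟂ : ∀ {I J K M} → (∀ b f f′ b′ → ¬ Square I J K M b f f′ b′) → R A I ⊗ L A J ⟂ R A K ⊗ L A M
  RL-⟂ {I} {J} {K} {M} noSquare = orthogonal (∑-zero (λ f → ∑-zero (λ f′ →
    ∑*∑≡0 (λ b → L A I b f * L A J b f′) (λ b′ → L A K b′ f′ * L A M b′ f)
          (λ b b′ → L-product-vanishes b f f′ b′ (noSquare b f f′ b′)))))

  -- The side conditions are decidable, so for concrete colours they hold by evaluation.
  fermionic-⟂ : ∀ I J K M → {False (I ≟ J)} → {False (equalOrDisjoint? I J K M)} →
    fermionic I J ⟂ fermionic K M
  fermionic-⟂ I J K M {I≢J} {¬equalOrDisjoint} = orthogonal
    (trans (tr-⊗-cong (fermionic≐RL I J) (fermionic≐RL K M))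
           (tr-⊗≡0 (RL-⟂ (λ b f f′ b′ sq →
              toWitnessFalse ¬equalOrDisjoint (Square-equalOrDisjoint (toWitnessFalse I≢J) sq)))))

  tr-fermionic-sq : ∀ I J K M →
    tr (restrictF (sq (φ₂ A I J ⊕ φ₂ A K M))) ≡ tr (sq (fermionic I J ⊕ fermionic K M))
  tr-fermionic-sq I J K M = tr-topLeft-sq (φ₂ A I J ⊕ φ₂ A K M)
    (λ f b → cong₂ _+_ (topRight-φ₂ I J f b) (topRight-φ₂ K M f b))

  Y₁ Y₂ Y₃ : Mat 4 4
  Y₁ = fermionic c1 c2 ⊕ fermionic c3 c4
  Y₂ = fermionic c1 c3 ⊕ fermionic c2 c4
  Y₃ = fermionic c1 c4 ⊕ fermionic c2 c3

  X≐Y₁⊕Y₂⊕Y₃ : X A ≐ Y₁ ⊕ (Y₂ ⊕ Y₃)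
  X≐Y₁⊕Y₂⊕Y₃ f f′ = regroup (F c1 c2) (F c1 c3) (F c1 c4) (F c2 c3) (F c2 c4) (F c3 c4)
    where
    F : Colour → Colour → ℤ
    F I J = fermionic I J f f′

    regroup : ∀ a b c d e h → a + (b + (c + (d + (e + h)))) ≡ (a + h) + ((b + e) + (c + d))
    regroup = solve-∀

  Y₁⟂Y₂ : Y₁ ⟂ Y₂
  Y₁⟂Y₂ = ⟂-⊕ˡ (⟂-⊕ʳ (fermionic-⟂ c1 c2 c1 c3) (fermionic-⟂ c1 c2 c2 c4))
               (⟂-⊕ʳ (fermionic-⟂ c3 c4 c1 c3) (fermionic-⟂ c3 c4 c2 c4))

  Y₁⟂Y₃ : Y₁ ⟂ Y₃
  Y₁⟂Y₃ = ⟂-⊕ˡ (⟂-⊕ʳ (fermionic-⟂ c1 c2 c1 c4) (fermionic-⟂ c1 c2 c2 c3))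
               (⟂-⊕ʳ (fermionic-⟂ c3 c4 c1 c4) (fermionic-⟂ c3 c4 c2 c3))

  Y₂⟂Y₃ : Y₂ ⟂ Y₃
  Y₂⟂Y₃ = ⟂-⊕ˡ (⟂-⊕ʳ (fermionic-⟂ c1 c3 c1 c4) (fermionic-⟂ c1 c3 c2 c3))
               (⟂-⊕ʳ (fermionic-⟂ c2 c4 c1 c4) (fermionic-⟂ c2 c4 c2 c3))

  RHS≡∑trY² : RHS A ≡ tr (sq Y₁) + (tr (sq Y₂) + tr (sq Y₃))
  RHS≡∑trY² = begin
    tr (S c1 c2 c3 c4 ⊕ (S c1 c3 c2 c4 ⊕ S c1 c4 c2 c3))
      ≡⟨ tr-⊕ (S c1 c2 c3 c4) (S c1 c3 c2 c4 ⊕ S c1 c4 c2 c3) ⟩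
    tr (S c1 c2 c3 c4) + tr (S c1 c3 c2 c4 ⊕ S c1 c4 c2 c3)
      ≡⟨ cong (tr (S c1 c2 c3 c4) +_) (tr-⊕ (S c1 c3 c2 c4) (S c1 c4 c2 c3)) ⟩
    tr (S c1 c2 c3 c4) + (tr (S c1 c3 c2 c4) + tr (S c1 c4 c2 c3))
      ≡⟨ cong₂ _+_ (tr-fermionic-sq c1 c2 c3 c4)
                   (cong₂ _+_ (tr-fermionic-sq c1 c3 c2 c4) (tr-fermionic-sq c1 c4 c2 c3)) ⟩
    tr (sq Y₁) + (tr (sq Y₂) + tr (sq Y₃)) ∎
    where
    S : Colour → Colour → Colour → Colour → Mat 4 4
    S I J K M = restrictF (sq (φ₂ A I J ⊕ φ₂ A K M))

lemma6p1 : ∀ (A : Adinkra) → tr (X A ⊗ X A) ≡ RHS A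
lemma6p1 A = begin
  tr (sq (X A))                                      ≡⟨ tr-⊗-cong (X≐Y₁⊕Y₂⊕Y₃ A) (X≐Y₁⊕Y₂⊕Y₃ A) ⟩
  tr (sq (Y₁ A ⊕ (Y₂ A ⊕ Y₃ A)))                     ≡⟨ tr-sq-⊕ (⟂-⊕ʳ (Y₁⟂Y₂ A) (Y₁⟂Y₃ A)) ⟩
  tr (sq (Y₁ A)) + tr (sq (Y₂ A ⊕ Y₃ A))             ≡⟨ cong (tr (sq (Y₁ A)) +_) (tr-sq-⊕ (Y₂⟂Y₃ A)) ⟩
  tr (sq (Y₁ A)) + (tr (sq (Y₂ A)) + tr (sq (Y₃ A))) ≡⟨ sym (RHS≡∑trY² A) ⟩
  RHS A ∎
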